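{- Let $(V,d)$ be a finite metric space and $F,F^*\subseteq V$ with $|F|=|F^*|=k$; let $t\ge1$ be an integer. Let $\eta:F^*\to F$ map each optimal facility to a closest facility of $F$, and let $\deg(r)=|\eta^{ -1}(r)|$ for $r\in F$. Construct sequences $(R_i)$, $(F^*_i)$ as follows: set $G=F$, $G^*=F^*$; while some $r\in G$ has $\deg(r)>0$, let $R_i$ consist of $r$ together with any $\deg(r)-1$ elements of $G$ of degree $0$, let $F^*_i=\eta^{ -1}(R_i)$, remove $R_i$ from $G$ and $F^*_i$ from $G^*$, and increase $i$; finally let the last pair be $(G,G^*)$. Let $\varphi:V\to F$, $\varphi^*:V\to F^*$ be closest-facility maps, $A_j=d(j,\varphi(j))$, $O_j=d(j,\varphi^*(j))$, and for sets $X\subseteq F$, $X^*\subseteq F^*$ let $N(X)=\{j:\varphi(j)\in X\}$, $N^*(X^*)=\{j:\varphi^*(j)\in X^*\}$. If $(R_i,F^*_i)$ is one of the constructed pairs with $|R_i|=|F^*_i|\le t$, then \[\mathrm{kmed}\big((F\setminus R_i)\cup F^*_i\big)-\mathrm{kmed}(F)\le\sum_{j\in N^*(F^*_i)}(O_j-A_j)+\sum_{j\in N(R_i)}2\,O_j,\] where $\mathrm{kmed}(G)=\sum_{j\in V}d(j,G)$ with $d(j,G)=\min_{g\in G}d(j,g)$.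
   Context: All points of $V$ are clients. Ties in closest-facility maps are broken arbitrarily. In the construction the degrees are those with respect to the fixed map $\eta$; the construction always finds enough degree-$0$ elements, and $|R_i|=|F^*_i|$ for every constructed pair. -}

module Defs where

open import Level using (Level; _⊔_) renaming (suc to lsuc)
open import Data.Nat using (ℕ; zero; suc) renaming (_<_ to _<ℕ_)
open import Data.Bool using (Bool; true; false; _∧_; if_then_else_)
open import Data.Fin using (Fin) renaming (zero to fzero; suc to fsuc)
open import Data.Fin.Subset using (Subset; _∈_; _⊆_; _─_; ∣_∣; ⁅_⁆)
open import Data.Vec using (Vec; []; _∷_; lookup; tabulate)
open import Data.Maybe using (Maybe; just; nothing; fromMaybe)
open import Data.List using (List; []; _∷_)
open import Data.Product using (_×_; _,_)
open import Data.Sum using (inj₁; inj₂)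
open import Function using (_∘_)
open import Relation.Binary using (Rel; IsTotalOrder)
open import Relation.Binary.PropositionalEquality using (_≡_; _≢_)
open import Algebra.Bundles using (CommutativeRing)

-- A (totally) ordered commutative ring: the real numbers are an instance.
record OrderedCommRing (c ℓ₁ ℓ₂ : Level) : Set (lsuc (c ⊔ ℓ₁ ⊔ ℓ₂)) where
  field
    commRing : CommutativeRing c ℓ₁
  open CommutativeRing commRing public
  infix 4 _≼_
  field
    _≼_          : Rel Carrier ℓ₂
    isTotalOrder : IsTotalOrder _≈_ _≼_
    +-mono-≼     : ∀ {x y} z → x ≼ y → (x + z) ≼ (y + z)
    *-nonneg     : ∀ {x y} → 0# ≼ x → 0# ≼ y → 0# ≼ (x * y)

  min : Carrier → Carrier → Carrier
  min x y with IsTotalOrder.total isTotalOrder x y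
  ... | inj₁ _ = x
  ... | inj₂ _ = y

module _ {c ℓ₁ ℓ₂ : Level} (O : OrderedCommRing c ℓ₁ ℓ₂) where
  open OrderedCommRing O

  record IsMetric {n : ℕ} (d : Fin n → Fin n → Carrier) : Set (c ⊔ ℓ₁ ⊔ ℓ₂) where
    field
      dist-self : ∀ x → d x x ≈ 0#
      dist-zero : ∀ x y → d x y ≈ 0# → x ≡ y
      dist-sym  : ∀ x y → d x y ≈ d y x
      dist-tri  : ∀ x y z → d x z ≼ (d x y + d y z)

  sumOver : ∀ {n} → Subset n → (Fin n → Carrier) → Carrier
  sumOver [] f = 0#
  sumOver (b ∷ p) f = (if b then f fzero else 0#) + sumOver p (f ∘ fsuc)

  minOver : ∀ {n} → Subset n → (Fin n → Carrier) → Maybe Carrier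
  minOver [] f = nothing
  minOver (false ∷ p) f = minOver p (f ∘ fsuc)
  minOver (true ∷ p) f with minOver p (f ∘ fsuc)
  ... | nothing = just (f fzero)
  ... | just m  = just (min (f fzero) m)

  -- d(j, G) = min_{g ∈ G} d(j, g); only ever used with G nonempty
  distTo : ∀ {n} → (Fin n → Fin n → Carrier) → Fin n → Subset n → Carrier
  distTo d j G = fromMaybe 0# (minOver G (d j))

  kmed : ∀ {n} → (Fin n → Fin n → Carrier) → Subset n → Carrier
  kmed {n} d G = sumOver (tabulate (λ _ → true)) (λ j → distTo d j G)

  IsClosestMap : ∀ {n} → (Fin n → Fin n → Carrier) → Subset n → Subset n →
                 (Fin n → Fin n) → Set (ℓ₂)
  IsClosestMap d F D m = ∀ j → j ∈ D → (m j ∈ F) × (∀ g → g ∈ F → d j (m j) ≼ d j g)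

-- preimage η⁻¹(R) ∩ F*  (η is only meaningful on F*)
preimage : ∀ {n} → (Fin n → Fin n) → Subset n → Subset n → Subset n
preimage η Fs R = tabulate (λ f → lookup Fs f ∧ lookup R (η f))

NSet : ∀ {n} → (Fin n → Fin n) → Subset n → Subset n
NSet m X = tabulate (λ j → lookup X (m j))

-- deg(r) = |η⁻¹(r)|, with respect to the fixed map η on all of F*
deg : ∀ {n} → (Fin n → Fin n) → Subset n → Fin n → ℕ
deg η Fs r = ∣ preimage η Fs ⁅ r ⁆ ∣

-- Run η F* G G* ps : ps is a possible list of pairs produced by the
-- construction started from current sets (G, G*); the last pair is the final (G, G*).
data Run {n : ℕ} (η : Fin n → Fin n) (Fs : Subset n) :
         Subset n → Subset n → List (Subset n × Subset n) → Set where
  stop : ∀ {G Gs} → (∀ r → r ∈ G → deg η Fs r ≡ 0) →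
         Run η Fs G Gs ((G , Gs) ∷ [])
  step : ∀ {G Gs R rest} (r : Fin n) → r ∈ G → 0 <ℕ deg η Fs r →
         R ⊆ G → r ∈ R → ∣ R ∣ ≡ deg η Fs r →
         (∀ x → x ∈ R → x ≢ r → deg η Fs x ≡ 0) →
         Run η Fs (G ─ R) (Gs ─ preimage η Fs R) rest →
         Run η Fs G Gs ((R , preimage η Fs R) ∷ rest)

-- Fix a client j, let o = φ*(j), A = d(j, φ j) and O = d(j, o).  After the swap,
-- j can still reach o if o ∈ F*ᵢ (cost O); otherwise η(o) survives, because the
-- construction puts all of η⁻¹(Rᵢ) into F*ᵢ, and the triangle inequality together with
-- d(o, η o) ≤ d(o, φ j) gives cost at most 2O + A; and if φ j ∉ Rᵢ it keeps φ j
-- (cost A).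
module Submission where

open import Defs
open import Level using (Level)
open import Data.Nat using (ℕ; zero; suc; _≤_; z<s) renaming (_<_ to _<ℕ_)
open import Data.Nat.Properties using (<-irrefl)
open import Data.Bool using (true; false; _∧_; if_then_else_)
open import Data.Fin using (Fin) renaming (zero to fzero; suc to fsuc)
open import Data.Fin.Subset using (Subset; ∣_∣; _─_; _∪_; ⊤; _∈_; _∉_)
open import Data.Fin.Subset.Properties using (∈⊤; x∈p∪q⁺; x∈p∧x∉q⇒x∈p─q; x∈⁅x⁆)
open import Data.Vec using ([]; _∷_; lookup; tabulate; here; there)
open import Data.Vec.Properties using ([]=⇒lookup; lookup⇒[]=; lookup∘tabulate)
open import Data.Maybe using (just; nothing)
open import Data.List using (List)
open import Data.List.Membership.Propositional using () renaming (_∈_ to _∈ˡ_)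
open import Data.List.Relation.Unary.Any using () renaming (here to hereˡ; there to thereˡ)
open import Data.Product using (_×_; _,_; proj₁; proj₂; ∃-syntax)
open import Data.Sum using (inj₁; inj₂; _⊎_)
open import Function using (_∘_)
open import Relation.Binary using (IsTotalOrder; Poset)
open import Relation.Binary.PropositionalEquality as ≡ using (_≡_)
open import Data.Empty using (⊥-elim)
import Algebra.Properties.AbelianGroup as AbelianGroupProperties
import Algebra.Properties.CommutativeMonoid.Sum as MonoidSum
import Relation.Binary.Reasoning.PartialOrder as ≼-Reasoning

x∈p⇒0<∣p∣ : ∀ {n} {x : Fin n} {p : Subset n} → x ∈ p → 0 <ℕ ∣ p ∣
x∈p⇒0<∣p∣ {p = true ∷ p}  here       = z<s
x∈p⇒0<∣p∣ {p = true ∷ p}  (there _)  = z<s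
x∈p⇒0<∣p∣ {p = false ∷ p} (there x∈p) = x∈p⇒0<∣p∣ x∈p

lookup≡false⇒∉ : ∀ {n} {x : Fin n} {p : Subset n} → lookup p x ≡ false → x ∉ p
lookup≡false⇒∉ p[x]≡false x∈p with ≡.trans (≡.sym ([]=⇒lookup x∈p)) p[x]≡false
... | ()

∈-preimage⁺ : ∀ {n} (η : Fin n → Fin n) {Fs R : Subset n} {o} →
              o ∈ Fs → η o ∈ R → o ∈ preimage η Fs R
∈-preimage⁺ η {o = o} o∈Fs ηo∈R = lookup⇒[]= o _
  (≡.trans (lookup∘tabulate _ o) (≡.cong₂ _∧_ ([]=⇒lookup o∈Fs) ([]=⇒lookup ηo∈R)))

lookup-NSet : ∀ {n} (m : Fin n → Fin n) (X : Subset n) j → lookup (NSet m X) j ≡ lookup X (m j)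
lookup-NSet m X = lookup∘tabulate (λ j → lookup X (m j))

-- The last pair (G, G*) is covered too: there no element of G has positive degree.
run-preimage-⊆ : ∀ {n} {η : Fin n → Fin n} {Fs G Gs ps} → Run η Fs G Gs ps →
                 ∀ {R Rs} → (R , Rs) ∈ˡ ps → ∀ {o} → o ∈ Fs → η o ∈ R → o ∈ Rs
run-preimage-⊆ {η = η} (stop noDegree) (hereˡ ≡.refl) o∈Fs ηo∈G =
  ⊥-elim (<-irrefl (≡.sym (noDegree _ ηo∈G)) (x∈p⇒0<∣p∣ (∈-preimage⁺ η o∈Fs (x∈⁅x⁆ _))))
run-preimage-⊆ {η = η} (step _ _ _ _ _ _ _ _) (hereˡ ≡.refl) = ∈-preimage⁺ η
run-preimage-⊆ (step _ _ _ _ _ _ _ rest) (thereˡ pair∈ps) = run-preimage-⊆ rest pair∈ps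

module OrderedCommRingProperties {c ℓ₁ ℓ₂ : Level} (O : OrderedCommRing c ℓ₁ ℓ₂) where
  open OrderedCommRing O renaming (+-mono-≼ to +-monoˡ-≼)
  open IsTotalOrder isTotalOrder public
    using () renaming (refl to ≼-refl; trans to ≼-trans; reflexive to ≼-reflexive; antisym to ≼-antisym)
  open AbelianGroupProperties +-abelianGroup using (⁻¹-∙-comm; ε⁻¹≈ε)
  open MonoidSum +-commutativeMonoid public using (sum; ∑-distrib-+)

  poset : Poset c ℓ₁ ℓ₂
  poset = record { isPartialOrder = IsTotalOrder.isPartialOrder isTotalOrder }

  +-monoʳ-≼ : ∀ {x y} z → x ≼ y → z + x ≼ z + y
  +-monoʳ-≼ {x} {y} z x≼y =
    ≼-trans (≼-reflexive (+-comm z x)) (≼-trans (+-monoˡ-≼ z x≼y) (≼-reflexive (+-comm y z)))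

  +-mono-≼ : ∀ {x y u v} → x ≼ y → u ≼ v → x + u ≼ y + v
  +-mono-≼ {y = y} {u} x≼y u≼v = ≼-trans (+-monoˡ-≼ u x≼y) (+-monoʳ-≼ y u≼v)

  x≼x+y : ∀ x {y} → 0# ≼ y → x ≼ x + y
  x≼x+y x 0≼y = ≼-trans (≼-reflexive (sym (+-identityʳ x))) (+-monoʳ-≼ x 0≼y)

  x+y-y≈x : ∀ x y → (x + y) - y ≈ x
  x+y-y≈x x y = trans (+-assoc x y (- y)) (trans (+-congˡ (-‿inverseʳ y)) (+-identityʳ x))

  min-≼ˡ : ∀ x y → min x y ≼ x
  min-≼ˡ x y with IsTotalOrder.total isTotalOrder x y
  ... | inj₁ _   = ≼-refl
  ... | inj₂ y≼x = y≼x

  min-≼ʳ : ∀ x y → min x y ≼ y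
  min-≼ʳ x y with IsTotalOrder.total isTotalOrder x y
  ... | inj₁ x≼y = x≼y
  ... | inj₂ _   = ≼-refl

  min-sel : ∀ x y → min x y ≡ x ⊎ min x y ≡ y
  min-sel x y with IsTotalOrder.total isTotalOrder x y
  ... | inj₁ _ = inj₁ ≡.refl
  ... | inj₂ _ = inj₂ ≡.refl

  sum-mono-≼ : ∀ {n} {f g : Fin n → Carrier} → (∀ j → f j ≼ g j) → sum f ≼ sum g
  sum-mono-≼ {zero}  f≼g = ≼-refl
  sum-mono-≼ {suc n} f≼g = +-mono-≼ (f≼g fzero) (sum-mono-≼ (f≼g ∘ fsuc))

  -‿sum : ∀ {n} (f : Fin n → Carrier) → - sum f ≈ sum (λ j → - f j)
  -‿sum {zero}  f = ε⁻¹≈ε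
  -‿sum {suc n} f = trans (sym (⁻¹-∙-comm _ _)) (+-congˡ (-‿sum (f ∘ fsuc)))

  ∑-distrib-- : ∀ {n} (f g : Fin n → Carrier) → sum (λ j → f j - g j) ≈ sum f - sum g
  ∑-distrib-- f g = trans (∑-distrib-+ f (λ j → - g j)) (+-congˡ (sym (-‿sum g)))

  sumOver-⊤ : ∀ {n} (f : Fin n → Carrier) → sumOver O (tabulate (λ _ → true)) f ≡ sum f
  sumOver-⊤ {zero}  f = ≡.refl
  sumOver-⊤ {suc n} f = ≡.cong (f fzero +_) (sumOver-⊤ (f ∘ fsuc))

  sumOver≡sum-if : ∀ {n} (p : Subset n) (f : Fin n → Carrier) →
                   sumOver O p f ≡ sum (λ j → if lookup p j then f j else 0#)
  sumOver≡sum-if []      f = ≡.refl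
  sumOver≡sum-if (b ∷ p) f = ≡.cong (_ +_) (sumOver≡sum-if p (f ∘ fsuc))

  minOver-nonempty : ∀ {n} {G : Subset n} (f : Fin n → Carrier) {g} → g ∈ G →
                     ∃[ m ] minOver O G f ≡ just m
  minOver-nonempty {G = true ∷ G} f _ with minOver O G (f ∘ fsuc)
  ... | nothing = _ , ≡.refl
  ... | just _  = _ , ≡.refl
  minOver-nonempty {G = false ∷ G} f (there g∈G) = minOver-nonempty (f ∘ fsuc) g∈G

  minOver-≼ : ∀ {n} {G : Subset n} (f : Fin n → Carrier) {m} → minOver O G f ≡ just m →
              ∀ {g} → g ∈ G → m ≼ f g
  minOver-≼ {G = false ∷ G} f eq (there g∈G) = minOver-≼ (f ∘ fsuc) eq g∈G
  minOver-≼ {G = true ∷ G} f eq g∈G with minOver O G (f ∘ fsuc) in eqᵗ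
  minOver-≼ f ≡.refl here | nothing = ≼-refl
  minOver-≼ f ≡.refl (there g∈G) | nothing
    with ≡.trans (≡.sym eqᵗ) (proj₂ (minOver-nonempty (f ∘ fsuc) g∈G))
  ... | ()
  minOver-≼ f ≡.refl here        | just m = min-≼ˡ _ _
  minOver-≼ f ≡.refl (there g∈G) | just m = ≼-trans (min-≼ʳ _ _) (minOver-≼ (f ∘ fsuc) eqᵗ g∈G)

  minOver-attained : ∀ {n} {G : Subset n} (f : Fin n → Carrier) {m} → minOver O G f ≡ just m →
                     ∃[ g ] g ∈ G × m ≡ f g
  minOver-attained {G = false ∷ G} f eq with minOver-attained (f ∘ fsuc) eq
  ... | g , g∈G , m≡fg = fsuc g , there g∈G , m≡fg
  minOver-attained {G = true ∷ G} f eq with minOver O G (f ∘ fsuc) in eqᵗ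
  minOver-attained f ≡.refl | nothing = fzero , here , ≡.refl
  minOver-attained f ≡.refl | just m with min-sel (f fzero) m
  ... | inj₁ min≡f0 = fzero , here , min≡f0
  ... | inj₂ min≡m with minOver-attained (f ∘ fsuc) eqᵗ
  ...   | g , g∈G , m≡fg = fsuc g , there g∈G , ≡.trans min≡m m≡fg

  module _ {n : ℕ} (d : Fin n → Fin n → Carrier) where

    distTo-≼ : ∀ j {G g} → g ∈ G → distTo O d j G ≼ d j g
    distTo-≼ j {G} g∈G with minOver-nonempty (d j) g∈G
    ... | m , eq rewrite eq = minOver-≼ (d j) eq g∈G

    distTo-closest : ∀ {G D m} → IsClosestMap O d G D m → ∀ {j} → j ∈ D → distTo O d j G ≈ d j (m j)
    distTo-closest {G} {m = m} closest {j} j∈D = ≼-antisym (distTo-≼ j mj∈G) closest≼distTo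
      where
      mj∈G : m j ∈ G
      mj∈G = proj₁ (closest j j∈D)
      closest≼distTo : d j (m j) ≼ distTo O d j G
      closest≼distTo with minOver-nonempty (d j) mj∈G
      ... | μ , eq rewrite eq with minOver-attained (d j) eq
      ...   | g , g∈G , μ≡djg rewrite μ≡djg = proj₂ (closest j j∈D) g g∈G

module FacilitySwap {c ℓ₁ ℓ₂ : Level} (O : OrderedCommRing c ℓ₁ ℓ₂) where
  open OrderedCommRing O renaming (+-mono-≼ to +-monoˡ-≼)
  open OrderedCommRingProperties O
  open ≼-Reasoning poset

  module _ {n : ℕ} {d : Fin n → Fin n → Carrier} (metric : IsMetric O d) where
    open IsMetric metric

    dist-nonneg : ∀ x y → 0# ≼ d x y
    dist-nonneg x y with IsTotalOrder.total isTotalOrder 0# (d x y)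
    ... | inj₁ 0≼d = 0≼d
    ... | inj₂ d≼0 = begin
      0#              ≈⟨ sym (dist-self x) ⟩
      d x x           ≤⟨ dist-tri x y x ⟩
      d x y + d y x   ≈⟨ +-congˡ (dist-sym y x) ⟩
      d x y + d x y   ≤⟨ +-monoʳ-≼ (d x y) d≼0 ⟩
      d x y + 0#      ≈⟨ +-identityʳ (d x y) ⟩
      d x y           ∎

    module _ {F Fs R Rs : Subset n} {η φ φs : Fin n → Fin n}
             (ηClosest : IsClosestMap O d F Fs η)
             (φClosest : IsClosestMap O d F ⊤ φ)
             (φsClosest : IsClosestMap O d Fs ⊤ φs)
             (preimage⊆Rs : ∀ {o} → o ∈ Fs → η o ∈ R → o ∈ Rs)
             (j : Fin n) where

      private
        S : Subset n
        S = (F ─ R) ∪ Rs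
        o : Fin n
        o = φs j
        A Oj : Carrier
        A = d j (φ j)
        Oj = d j o
        φj∈F : φ j ∈ F
        φj∈F = proj₁ (φClosest j ∈⊤)
        o∈Fs : o ∈ Fs
        o∈Fs = proj₁ (φsClosest j ∈⊤)

      distTo-swap-≼-optimal : o ∈ Rs → distTo O d j S ≼ Oj
      distTo-swap-≼-optimal o∈Rs = distTo-≼ d j {S} (x∈p∪q⁺ (inj₂ o∈Rs))

      distTo-swap-≼-kept : φ j ∉ R → distTo O d j S ≼ A
      distTo-swap-≼-kept φj∉R = distTo-≼ d j {S} (x∈p∪q⁺ (inj₁ (x∈p∧x∉q⇒x∈p─q φj∈F φj∉R)))

      distTo-swap-≼-detour : o ∉ Rs → distTo O d j S ≼ (Oj + Oj) + A
      distTo-swap-≼-detour o∉Rs = begin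
        distTo O d j S        ≤⟨ distTo-≼ d j {S} ηo∈S ⟩
        d j (η o)             ≤⟨ dist-tri j o (η o) ⟩
        Oj + d o (η o)        ≤⟨ +-monoʳ-≼ Oj (proj₂ (ηClosest o o∈Fs) (φ j) φj∈F) ⟩
        Oj + d o (φ j)        ≤⟨ +-monoʳ-≼ Oj (dist-tri o j (φ j)) ⟩
        Oj + (d o j + A)      ≈⟨ +-congˡ (+-congʳ (dist-sym o j)) ⟩
        Oj + (Oj + A)         ≈⟨ sym (+-assoc Oj Oj A) ⟩
        (Oj + Oj) + A         ∎
        where
        ηo∉R : η o ∉ R
        ηo∉R ηo∈R = o∉Rs (preimage⊆Rs o∈Fs ηo∈R)
        ηo∈S : η o ∈ S
        ηo∈S = x∈p∪q⁺ (inj₁ (x∈p∧x∉q⇒x∈p─q (proj₁ (ηClosest o o∈Fs)) ηo∉R))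

      distTo-swap-gain : distTo O d j S - distTo O d j F ≼
        (if lookup (NSet φs Rs) j then Oj - A else 0#) + (if lookup (NSet φ R) j then Oj + Oj else 0#)
      distTo-swap-gain rewrite lookup-NSet φs Rs j | lookup-NSet φ R j =
        ≼-trans (≼-reflexive (+-congˡ (-‿cong (distTo-closest d φClosest ∈⊤))))
                (gain-cases (lookup Rs o) ≡.refl (lookup R (φ j)) ≡.refl)
        where
        0≼[b]2O : ∀ b → 0# ≼ (if b then Oj + Oj else 0#)
        0≼[b]2O true  = ≼-trans (≼-reflexive (sym (+-identityʳ 0#)))
                                (+-mono-≼ (dist-nonneg j o) (dist-nonneg j o))
        0≼[b]2O false = ≼-refl

        gain-cases : ∀ b → lookup Rs o ≡ b → ∀ b' → lookup R (φ j) ≡ b' →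
               distTo O d j S - A ≼ (if b then Oj - A else 0#) + (if b' then Oj + Oj else 0#)
        gain-cases true o∈Rs b' _ = begin
          distTo O d j S - A                   ≤⟨ +-monoˡ-≼ (- A) (distTo-swap-≼-optimal (lookup⇒[]= o Rs o∈Rs)) ⟩
          Oj - A                               ≤⟨ x≼x+y (Oj - A) (0≼[b]2O b') ⟩
          Oj - A + (if b' then Oj + Oj else 0#) ∎
        gain-cases false o∉Rs true _ = begin
          distTo O d j S - A                   ≤⟨ +-monoˡ-≼ (- A) (distTo-swap-≼-detour (lookup≡false⇒∉ o∉Rs)) ⟩
          (Oj + Oj) + A - A                    ≈⟨ x+y-y≈x (Oj + Oj) A ⟩
          Oj + Oj                              ≈⟨ sym (+-identityˡ (Oj + Oj)) ⟩
          0# + (Oj + Oj)                       ∎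
        gain-cases false _ false φj∉R = begin
          distTo O d j S - A                   ≤⟨ +-monoˡ-≼ (- A) (distTo-swap-≼-kept (lookup≡false⇒∉ φj∉R)) ⟩
          A - A                                ≈⟨ -‿inverseʳ A ⟩
          0#                                   ≈⟨ sym (+-identityʳ 0#) ⟩
          0# + 0#                              ∎

mainTheorem6 : ∀ {c ℓ₁ ℓ₂ : Level} (O : OrderedCommRing c ℓ₁ ℓ₂) →
    let open OrderedCommRing O in
    (n k t : ℕ) (d : Fin n → Fin n → Carrier) → IsMetric O d →
    (F Fs : Subset n) → ∣ F ∣ ≡ k → ∣ Fs ∣ ≡ k → 1 ≤ t →
    (η : Fin n → Fin n) → IsClosestMap O d F Fs η →
    (φ φs : Fin n → Fin n) → IsClosestMap O d F ⊤ φ → IsClosestMap O d Fs ⊤ φs →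
    (ps : List (Subset n × Subset n)) → Run η Fs F Fs ps →
    (R Rs : Subset n) → (R , Rs) ∈ˡ ps → ∣ R ∣ ≡ ∣ Rs ∣ → ∣ R ∣ ≤ t →
    (kmed O d ((F ─ R) ∪ Rs) - kmed O d F)
      ≼ (sumOver O (NSet φs Rs) (λ j → d j (φs j) - d j (φ j))
         + sumOver O (NSet φ R) (λ j → d j (φs j) + d j (φs j)))
mainTheorem6 O n _ _ d metric F Fs _ _ _ η ηClosest φ φs φClosest φsClosest _ run R Rs pair∈ps _ _ =
  begin
    kmed O d S - kmed O d F                ≡⟨ ≡.cong₂ _-_ (sumOver-⊤ dS) (sumOver-⊤ dF) ⟩
    sum dS - sum dF                        ≈⟨ sym (∑-distrib-- dS dF) ⟩
    sum (λ j → dS j - dF j)                ≤⟨ sum-mono-≼ gain ⟩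
    sum (λ j → [φs∈Rs] j + [φ∈R] j)        ≈⟨ ∑-distrib-+ [φs∈Rs] [φ∈R] ⟩
    sum [φs∈Rs] + sum [φ∈R]                ≡⟨ ≡.sym (≡.cong₂ _+_ (sumOver≡sum-if (NSet φs Rs) _) (sumOver≡sum-if (NSet φ R) _)) ⟩
    sumOver O (NSet φs Rs) (λ j → d j (φs j) - d j (φ j))
      + sumOver O (NSet φ R) (λ j → d j (φs j) + d j (φs j)) ∎
  where
  open OrderedCommRing O renaming (+-mono-≼ to +-monoˡ-≼)
  open OrderedCommRingProperties O
  open FacilitySwap O
  open ≼-Reasoning poset
  S : Subset n
  S = (F ─ R) ∪ Rs
  dS dF [φs∈Rs] [φ∈R] : Fin n → Carrier
  dS j = distTo O d j S
  dF j = distTo O d j F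
  [φs∈Rs] j = if lookup (NSet φs Rs) j then d j (φs j) - d j (φ j) else 0#
  [φ∈R] j = if lookup (NSet φ R) j then d j (φs j) + d j (φs j) else 0#
  gain : ∀ j → dS j - dF j ≼ [φs∈Rs] j + [φ∈R] j
  gain = distTo-swap-gain metric ηClosest φClosest φsClosest (run-preimage-⊆ run pair∈ps)
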